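{- Let $e,f$ be essential edges of a multigraph $H$, and let $W$ be any walk in $H$ that starts with $e$, ends with $f$, and traverses every edge at most once. Then every edge traversed by $W$ is essential.
   Context: Multigraphs are undirected and may have parallel edges and self-loops; self-loops and pairs of parallel edges count as cycles. An edge $e$ of $H$ is essential if it lies on a cycle of $H$, or $e$ is a bridge whose removal creates two new connected components each of which contains a cycle. -}

module Defs where

open import Data.Nat using (ℕ)
open import Data.Fin using (Fin)
open import Data.Product using (_×_; _,_; Σ; ∃; proj₁; proj₂)
open import Data.Sum using (_⊎_)
open import Data.List using (List; []; _∷_; head; last)
open import Data.List.Relation.Unary.All using (All)
open import Data.List.Relation.Unary.Unique.Propositional using (Unique)
open import Data.List.Membership.Propositional using (_∈_)
open import Relation.Binary.PropositionalEquality using (_≡_; _≢_)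
open import Relation.Nullary using (¬_)

-- The ordered pair is only a presentation;
-- edges are undirected (see Joins).  Parallel edges and loops allowed.
record Multigraph : Set where
  field
    V    : ℕ
    E    : ℕ
    ends : Fin E → Fin V × Fin V

open Multigraph public

Joins : (G : Multigraph) → Fin (E G) → Fin (V G) → Fin (V G) → Set
Joins G e x y = (ends G e ≡ (x , y)) ⊎ (ends G e ≡ (y , x))

data Walk (G : Multigraph) : Fin (V G) → Fin (V G) → Set where
  []   : ∀ {x} → Walk G x x
  step : ∀ {x y z} (e : Fin (E G)) → Joins G e x y → Walk G y z → Walk G x z

edges : ∀ {G x y} → Walk G x y → List (Fin (E G))
edges []            = []
edges (step e _ w)  = e ∷ edges w

-- list of vertices v0 ... v(k-1) (every vertex except the final one)
starts : ∀ {G x y} → Walk G x y → List (Fin (V G))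
starts []                 = []
starts (step {x} e _ w)   = x ∷ starts w

IsTrail : ∀ {G x y} → Walk G x y → Set
IsTrail w = Unique (edges w)

-- cycle: closed walk with at least one edge, no repeated edge, and no
-- repeated vertex apart from start = end.  (Loops: length 1; a pair of
-- parallel edges: length 2.)
IsCycle : ∀ {G x} → Walk G x x → Set
IsCycle w = (edges w ≢ []) × Unique (edges w) × Unique (starts w)

Avoids : ∀ {G x y} → Fin (E G) → Walk G x y → Set
Avoids e w = All (λ f → f ≢ e) (edges w)

LiesOnCycle : (G : Multigraph) → Fin (E G) → Set
LiesOnCycle G e = Σ (Fin (V G)) λ x → Σ (Walk G x x) λ w → IsCycle w × e ∈ edges w

ConnectedWithout : (G : Multigraph) → Fin (E G) → Fin (V G) → Fin (V G) → Set
ConnectedWithout G e u v = Σ (Walk G u v) λ w → Avoids e w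

ComponentHasCycleWithout : (G : Multigraph) → Fin (E G) → Fin (V G) → Set
ComponentHasCycleWithout G e u =
  Σ (Fin (V G)) λ x → Σ (Walk G x x) λ c →
    IsCycle c × Avoids e c × ConnectedWithout G e u x

EssentialBridge : (G : Multigraph) → Fin (E G) → Set
EssentialBridge G e =
  ¬ ConnectedWithout G e (proj₁ (ends G e)) (proj₂ (ends G e)) ×
  ComponentHasCycleWithout G e (proj₁ (ends G e)) ×
  ComponentHasCycleWithout G e (proj₂ (ends G e))

Essential : (G : Multigraph) → Fin (E G) → Set
Essential G e = LiesOnCycle G e ⊎ EssentialBridge G e

-- Let g be an edge of W other than e and f.  Since W is a trail, W = W₁ g W₂
-- with e on W₁ and f on W₂, and neither W₁ nor W₂ uses g.  If the ends of g
-- are joined in H - g, then g lies on a cycle.  Otherwise g is a bridge, and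
-- the end of g reached by W₁ is joined, avoiding g, to an end of e; the cycle
-- through e (if e lies on one) or the cycle on the far side of e (if e is an
-- essential bridge) therefore lies in the component of that end of g in H - g.
-- The same argument with f and W₂ handles the other end of g.
module Submission where

open import Defs
open import Data.Nat using (ℕ; zero; suc; _≤_; _<_; z≤n; s≤s)
open import Data.Nat.Properties using (<⇒≤)
open import Data.Fin using (Fin; _≟_)
open import Data.Fin.Properties using (any?; injective⇒≤)
open import Data.Maybe using (just)
open import Data.Maybe.Properties using (just-injective)
open import Data.List using (List; []; _∷_; _++_; head; last; length; lookup)
open import Data.List.Relation.Unary.All as All using (All; []; _∷_)
open import Data.List.Relation.Unary.All.Properties using (++⁻ˡ; ++⁻ʳ; anti-mono; ¬Any⇒All¬)
open import Data.List.Relation.Unary.Any using (here; there)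
import Data.List.Relation.Unary.Any as Any
open import Data.List.Relation.Unary.AllPairs using ([]; _∷_)
open import Data.List.Relation.Unary.Unique.Propositional using (Unique)
open import Data.List.Relation.Binary.Subset.Propositional using (_⊆_)
open import Data.List.Membership.Propositional using (_∈_)
open import Data.List.Membership.Propositional.Properties using (∈-lookup)
open import Data.Product using (Σ; ∃₂; _×_; _,_)
open import Data.Product.Properties using (≡-dec)
open import Data.Sum using (_⊎_; inj₁; inj₂)
open import Data.Empty using (⊥-elim)
open import Function using (_∘_)
open import Relation.Nullary using (¬_; Dec; yes; no)
open import Relation.Nullary.Decidable using (_×-dec_; _⊎-dec_; ¬?)
open import Relation.Binary.PropositionalEquality
  using (_≡_; _≢_; refl; sym; trans; cong; subst; ≢-sym)

module _ {A : Set} where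

  ++-unique⁻ : ∀ (xs : List A) {ys} → Unique (xs ++ ys) → Unique xs × Unique ys
  ++-unique⁻ []       u          = [] , u
  ++-unique⁻ (x ∷ xs) (x∉ ∷ u) with ++-unique⁻ xs u
  ... | uxs , uys = ++⁻ˡ xs x∉ ∷ uxs , uys

  unique-middle : ∀ (xs : List A) {y ys} → Unique (xs ++ y ∷ ys) →
    All (_≢ y) xs × All (_≢ y) ys
  unique-middle []       (y∉ ∷ _) = [] , All.map ≢-sym y∉
  unique-middle (x ∷ xs) (x∉ ∷ u) with unique-middle xs u
  ... | xs≢y , ys≢y = All.head (++⁻ʳ xs x∉) ∷ xs≢y , ys≢y

  lookup-injective : ∀ {xs : List A} → Unique xs → ∀ {i j} → lookup xs i ≡ lookup xs j → i ≡ j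
  lookup-injective (x∉ ∷ u) {Fin.zero}  {Fin.zero}  eq = refl
  lookup-injective (x∉ ∷ u) {Fin.zero}  {Fin.suc j} eq = ⊥-elim (All.lookup x∉ (∈-lookup j) eq)
  lookup-injective (x∉ ∷ u) {Fin.suc i} {Fin.zero}  eq = ⊥-elim (All.lookup x∉ (∈-lookup i) (sym eq))
  lookup-injective (x∉ ∷ u) {Fin.suc i} {Fin.suc j} eq = cong Fin.suc (lookup-injective u eq)

  head-++-∈ : ∀ (xs : List A) {x y ys} → head (xs ++ y ∷ ys) ≡ just x → y ≢ x → x ∈ xs
  head-++-∈ []      eq y≢x = ⊥-elim (y≢x (just-injective eq))
  head-++-∈ (_ ∷ _) eq y≢x = here (sym (just-injective eq))

  last-∈ : ∀ (xs : List A) {x} → last xs ≡ just x → x ∈ xs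
  last-∈ (_ ∷ [])     eq = here (sym (just-injective eq))
  last-∈ (_ ∷ z ∷ xs) eq = there (last-∈ (z ∷ xs) eq)

  last-++-∈ : ∀ (xs : List A) {x y ys} → last (xs ++ y ∷ ys) ≡ just x → y ≢ x → x ∈ ys
  last-++-∈ []           {ys = []}    eq y≢x = ⊥-elim (y≢x (just-injective eq))
  last-++-∈ []           {ys = _ ∷ _} eq y≢x = last-∈ _ eq
  last-++-∈ (_ ∷ [])     eq y≢x = last-++-∈ [] eq y≢x
  last-++-∈ (_ ∷ z ∷ xs) eq y≢x = last-++-∈ (z ∷ xs) eq y≢x

unique-length≤ : ∀ {n} {xs : List (Fin n)} → Unique xs → length xs ≤ n
unique-length≤ u = injective⇒≤ (lookup-injective u)

module WalksIn (H : Multigraph) where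

  private
    Vertex = Fin (V H)
    Edge   = Fin (E H)

  joins-sym : ∀ {g a b} → Joins H g a b → Joins H g b a
  joins-sym (inj₁ p) = inj₂ p
  joins-sym (inj₂ p) = inj₁ p

  joins-ends : ∀ {g x y a b} → Joins H g x y → Joins H g a b →
    (x ≡ a × y ≡ b) ⊎ (x ≡ b × y ≡ a)
  joins-ends (inj₁ p) (inj₁ q) with trans (sym p) q
  ... | refl = inj₁ (refl , refl)
  joins-ends (inj₁ p) (inj₂ q) with trans (sym p) q
  ... | refl = inj₂ (refl , refl)
  joins-ends (inj₂ p) (inj₁ q) with trans (sym p) q
  ... | refl = inj₂ (refl , refl)
  joins-ends (inj₂ p) (inj₂ q) with trans (sym p) q
  ... | refl = inj₁ (refl , refl)

  joins? : (g : Edge) (a b : Vertex) → Dec (Joins H g a b)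
  joins? g a b = ≡-dec _≟_ _≟_ (ends H g) (a , b) ⊎-dec ≡-dec _≟_ _≟_ (ends H g) (b , a)

  connected-refl : ∀ {g u} → ConnectedWithout H g u u
  connected-refl = [] , []

  connected-edge : ∀ {g h u v} → h ≢ g → Joins H h u v → ConnectedWithout H g u v
  connected-edge h≢g j = step _ j [] , h≢g ∷ []

  connected-trans : ∀ {g u v w} →
    ConnectedWithout H g u v → ConnectedWithout H g v w → ConnectedWithout H g u w
  connected-trans ([]           , [])        k = k
  connected-trans (step h j p   , h≢g ∷ avp) k with connected-trans (p , avp) k
  ... | q , avq = step h j q , h≢g ∷ avq

  connected-sym : ∀ {g u v} → ConnectedWithout H g u v → ConnectedWithout H g v u
  connected-sym ([]         , [])        = connected-refl
  connected-sym (step h j p , h≢g ∷ avp) =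
    connected-trans (connected-sym (p , avp)) (connected-edge h≢g (joins-sym j))

  connected-ends : ∀ {g h x y a b} → Joins H g x y → Joins H g a b →
    ConnectedWithout H h x y → ConnectedWithout H h a b
  connected-ends jxy jab k with joins-ends jxy jab
  ... | inj₁ (refl , refl) = k
  ... | inj₂ (refl , refl) = connected-sym k

  connected-to-endpoint : ∀ {e g t t' a b} (w : Walk H t t') → Avoids e w →
    g ∈ edges w → Joins H g a b → ConnectedWithout H e t a
  connected-to-endpoint (step h j w) (h≢e ∷ _) (here refl) jab with joins-ends j jab
  ... | inj₁ (refl , _) = connected-refl
  ... | inj₂ (_ , refl) = connected-edge h≢e j
  connected-to-endpoint (step h j w) (h≢e ∷ av) (there g∈w) jab =
    connected-trans (connected-edge h≢e j) (connected-to-endpoint w av g∈w jab)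

  record Split (g : Edge) {x y} (w : Walk H x y) : Set where
    constructor split
    field
      {a b}  : Vertex
      prefix : Walk H x a
      joins  : Joins H g a b
      suffix : Walk H b y
      edges-split : edges w ≡ edges prefix ++ g ∷ edges suffix

  split-at : ∀ {g x y} (w : Walk H x y) → g ∈ edges w → Split g w
  split-at (step h j w) (here refl) = split [] j w refl
  split-at (step h j w) (there g∈w) with split-at w g∈w
  ... | split p jg s eq = split (step h j p) jg s (cong (h ∷_) eq)

  trail-split : ∀ {g x y a b} {w : Walk H x y} {p : Walk H x a} {s : Walk H b y} →
    IsTrail w → edges w ≡ edges p ++ g ∷ edges s →
    Avoids g p × Avoids g s × IsTrail p × IsTrail s
  trail-split {p = p} tr eq with subst Unique eq tr
  ... | u with unique-middle (edges p) u | ++-unique⁻ (edges p) u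
  ... | avp , avs | trp , _ ∷ trs = avp , avs , trp , trs

  connected-across-closed-trail : ∀ {g z a b} (c : Walk H z z) → IsTrail c →
    g ∈ edges c → Joins H g a b → ConnectedWithout H g a b
  connected-across-closed-trail c tr g∈c jab with split-at c g∈c
  ... | split p jg s eq with trail-split {p = p} {s = s} tr eq
  ... | avp , avs , _ =
    connected-ends (joins-sym jg) jab (connected-trans (s , avs) (p , avp))

  trail-after-edge : ∀ {e g x y} (w : Walk H x y) → IsTrail w → e ∈ edges w → Avoids g w →
    ∃₂ λ c c' → Joins H e c c' × ConnectedWithout H e c' y × ConnectedWithout H g c' y
  trail-after-edge {g = g} w tr e∈w av with split-at w e∈w
  ... | split p je s eq with trail-split {p = p} {s = s} tr eq
  ... | _ , ave , _ =
    _ , _ , je , (s , ave) , (s , All.tail (++⁻ʳ (edges p) (subst (All (_≢ g)) eq av)))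

  trail-before-edge : ∀ {e g x y} (w : Walk H x y) → IsTrail w → e ∈ edges w → Avoids g w →
    ∃₂ λ c c' → Joins H e c c' × ConnectedWithout H e c' x × ConnectedWithout H g c' x
  trail-before-edge {g = g} w tr e∈w av with split-at w e∈w
  ... | split p je s eq with trail-split {p = p} {s = s} tr eq
  ... | ave , _ =
    _ , _ , joins-sym je , connected-sym (p , ave) ,
    connected-sym (p , ++⁻ˡ (edges p) (subst (All (_≢ g)) eq av))

  vertices : ∀ {x y} → Walk H x y → List Vertex
  vertices {x} []           = x ∷ []
  vertices {x} (step _ _ w) = x ∷ vertices w

  IsPath : ∀ {x y} → Walk H x y → Set
  IsPath w = Unique (vertices w)

  start-∈-vertices : ∀ {x y} (w : Walk H x y) → x ∈ vertices w
  start-∈-vertices []           = here refl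
  start-∈-vertices (step _ _ _) = here refl

  end-∈-vertices : ∀ {x y} (w : Walk H x y) → y ∈ vertices w
  end-∈-vertices []           = here refl
  end-∈-vertices (step _ _ w) = there (end-∈-vertices w)

  starts⊆vertices : ∀ {x y} (w : Walk H x y) → starts w ⊆ vertices w
  starts⊆vertices (step _ _ w) (here refl) = here refl
  starts⊆vertices (step _ _ w) (there v∈) = there (starts⊆vertices w v∈)

  endpoint-∈-vertices : ∀ {g x y a b} (w : Walk H x y) → g ∈ edges w →
    Joins H g a b → a ∈ vertices w
  endpoint-∈-vertices (step h j w) (here refl) jab with joins-ends j jab
  ... | inj₁ (refl , _) = here refl
  ... | inj₂ (_ , refl) = there (start-∈-vertices w)
  endpoint-∈-vertices (step h j w) (there g∈w) jab = there (endpoint-∈-vertices w g∈w jab)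

  path-starts : ∀ {x y} (w : Walk H x y) → IsPath w → Unique (y ∷ starts w)
  path-starts []           _          = [] ∷ []
  path-starts (step h j w) (x∉ ∷ pw) with path-starts w pw
  ... | y∉ ∷ us =
    (≢-sym (All.lookup x∉ (end-∈-vertices w)) ∷ y∉) ∷
    All.tabulate (All.lookup x∉ ∘ starts⊆vertices w) ∷ us

  path-trail : ∀ {x y} (w : Walk H x y) → IsPath w → IsTrail w
  path-trail []           _          = []
  path-trail (step h j w) (x∉ ∷ pw) =
    All.tabulate (λ { h∈w refl → All.lookup x∉ (endpoint-∈-vertices w h∈w j) refl }) ∷
    path-trail w pw

  length-vertices : ∀ {x y} (w : Walk H x y) → length (vertices w) ≡ suc (length (edges w))
  length-vertices []           = refl
  length-vertices (step _ _ w) = cong suc (length-vertices w)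

  path-length< : ∀ {x y} (w : Walk H x y) → IsPath w → length (edges w) < V H
  path-length< w pw = subst (_≤ V H) (length-vertices w) (unique-length≤ pw)

  suffix-from : ∀ {v x y} (w : Walk H x y) → v ∈ vertices w →
    Σ (Walk H v y) λ p → edges p ⊆ edges w × (IsPath w → IsPath p)
  suffix-from []           (here refl) = [] , (λ ()) , λ pw → pw
  suffix-from (step h j w) (here refl) = step h j w , (λ e∈ → e∈) , λ pw → pw
  suffix-from (step h j w) (there v∈w) with suffix-from w v∈w
  ... | p , p⊆w , path = p , there ∘ p⊆w , λ { (_ ∷ pw) → path pw }

  to-path : ∀ {x y} (w : Walk H x y) → Σ (Walk H x y) λ p → IsPath p × edges p ⊆ edges w
  to-path []                = [] , [] ∷ [] , λ ()
  to-path {x} (step h j w) with to-path w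
  ... | p , pp , p⊆w with Any.any? (x ≟_) (vertices p)
  ... | yes x∈p = let (q , q⊆p , path) = suffix-from p x∈p in
    q , path pp , there ∘ p⊆w ∘ q⊆p
  ... | no x∉p =
    step h j p , ¬Any⇒All¬ (vertices p) x∉p ∷ pp ,
    λ { (here refl) → here refl ; (there e∈p) → there (p⊆w e∈p) }

  connected-by-path : ∀ {g u v} → ConnectedWithout H g u v →
    Σ (Walk H u v) λ p → IsPath p × Avoids g p
  connected-by-path (w , av) with to-path w
  ... | p , pp , p⊆w = p , pp , anti-mono p⊆w av

  ConnectedWithoutIn : ℕ → Edge → Vertex → Vertex → Set
  ConnectedWithoutIn n g u v = Σ (Walk H u v) λ w → Avoids g w × length (edges w) ≤ n

  connectedWithoutIn? : ∀ n g u v → Dec (ConnectedWithoutIn n g u v)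
  connectedWithoutIn? n g u v with u ≟ v
  ... | yes refl = yes ([] , [] , z≤n)
  connectedWithoutIn? zero g u v | no u≢v =
    no λ { ([] , _) → u≢v refl ; (step _ _ _ , _ , ()) }
  connectedWithoutIn? (suc n) g u v | no u≢v
    with any? (λ h → any? (λ y → ¬? (h ≟ g) ×-dec (joins? h u y ×-dec connectedWithoutIn? n g y v)))
  ... | yes (h , y , h≢g , j , w , av , l) = yes (step h j w , h≢g ∷ av , s≤s l)
  ... | no no-step = no λ
    { ([] , _)                        → u≢v refl
    ; (step h j w , h≢g ∷ av , s≤s l) → no-step (h , _ , h≢g , j , w , av , l) }

  -- Searching walks of length at most V H suffices: a connection shortens to a path.
  connected? : ∀ g u v → Dec (ConnectedWithout H g u v)
  connected? g u v with connectedWithoutIn? (V H) g u v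
  ... | yes (w , av , _) = yes (w , av)
  ... | no ¬short = no λ k → let (p , pp , av) = connected-by-path k in
    ¬short (p , av , <⇒≤ (path-length< p pp))

  lies-on-cycle : ∀ {g a b} → Joins H g a b → ConnectedWithout H g b a → LiesOnCycle H g
  lies-on-cycle jab k with connected-by-path k
  ... | p , pp , avp =
    _ , step _ jab p , ((λ ()) , All.map ≢-sym avp ∷ path-trail p pp , path-starts p pp) , here refl

  essential-bridge : ∀ {g a b} → Joins H g a b → ¬ ConnectedWithout H g a b →
    ComponentHasCycleWithout H g a → ComponentHasCycleWithout H g b → EssentialBridge H g
  essential-bridge jab sep ca cb with joins-ends (inj₁ refl) jab
  ... | inj₁ (refl , refl) = sep , ca , cb
  ... | inj₂ (refl , refl) = sep ∘ connected-sym , cb , ca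

  essential-bridge-side : ∀ {e c c'} → EssentialBridge H e → Joins H e c c' →
    ¬ ConnectedWithout H e c c' × ComponentHasCycleWithout H e c
  essential-bridge-side (sep , c₁ , c₂) jcc' with joins-ends (inj₁ refl) jcc'
  ... | inj₁ (refl , refl) = sep , c₁
  ... | inj₂ (refl , refl) = sep ∘ connected-sym , c₂

  essential-if-bridge-sides : ∀ {g a b} → Joins H g a b →
    (¬ ConnectedWithout H g a b →
      ComponentHasCycleWithout H g a × ComponentHasCycleWithout H g b) →
    Essential H g
  essential-if-bridge-sides {g} {a} {b} jab sides with connected? g b a
  ... | yes k  = inj₁ (lies-on-cycle jab k)
  ... | no ¬k  with sides (¬k ∘ connected-sym)
  ...   | ca , cb = inj₂ (essential-bridge jab (¬k ∘ connected-sym) ca cb)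

  cycle-side : ∀ {e g a b c c'} → Joins H g a b → ¬ ConnectedWithout H g a b →
    LiesOnCycle H e → Joins H e c c' → ConnectedWithout H g c' a →
    ComponentHasCycleWithout H g a
  cycle-side jab sep (z , C , cyc@(_ , trC , _) , e∈C) je c'~a =
    z , C , cyc , C-avoids-g ,
    connected-trans (connected-sym c'~a)
      (connected-sym (connected-to-endpoint C C-avoids-g e∈C (joins-sym je)))
    where
    C-avoids-g = All.tabulate λ { g∈C refl → sep (connected-across-closed-trail C trC g∈C jab) }

  bridge-side : ∀ {e g a b c c'} → e ≢ g → Joins H g a b →
    Joins H e c c' → ¬ ConnectedWithout H e c c' → ComponentHasCycleWithout H e c →
    ConnectedWithout H g c' a → ConnectedWithout H e c' a →
    ComponentHasCycleWithout H g a
  bridge-side {e} {g} {c = c} e≢g jab je sep (z , C , cyc , C-avoids-e , (P , P-avoids-e))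
              c'~a∖g c'~a∖e =
    z , C , cyc , avoids-g C (P , P-avoids-e) C-avoids-e ,
    connected-trans (connected-sym c'~a∖g)
      (connected-trans (connected-edge e≢g (joins-sym je)) (P , avoids-g P connected-refl P-avoids-e))
    where
    -- An edge g in the component of c in H - e would join c to a, hence to c', in H - e.
    avoids-g : ∀ {t t'} (w : Walk H t t') → ConnectedWithout H e c t → Avoids e w → Avoids g w
    avoids-g w c~t av = All.tabulate λ { g∈w refl →
      sep (connected-trans c~t
             (connected-trans (connected-to-endpoint w av g∈w jab) (connected-sym c'~a∖e))) }

  essential-side : ∀ {e g a b c c'} → e ≢ g → Joins H g a b → ¬ ConnectedWithout H g a b →
    Essential H e → Joins H e c c' →
    ConnectedWithout H g c' a → ConnectedWithout H e c' a →
    ComponentHasCycleWithout H g a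
  essential-side e≢g jab sep (inj₁ cyc) je c'~a∖g _ = cycle-side jab sep cyc je c'~a∖g
  essential-side e≢g jab sep (inj₂ br) je c'~a∖g c'~a∖e with essential-bridge-side br je
  ... | sepₑ , comp = bridge-side e≢g jab je sepₑ comp c'~a∖g c'~a∖e

lemma5p2 : (H : Multigraph) (e f : Fin (E H)) →
    Essential H e → Essential H f →
    {x y : Fin (V H)} (W : Walk H x y) →
    head (edges W) ≡ just e → last (edges W) ≡ just f → IsTrail W →
    All (Essential H) (edges W)
lemma5p2 H e f ess-e ess-f W head≡e last≡f tr = All.tabulate essential
  where
  open WalksIn H

  essential : ∀ {g} → g ∈ edges W → Essential H g
  essential {g} g∈W with g ≟ e | g ≟ f
  ... | yes refl | _        = ess-e
  ... | no _     | yes refl = ess-f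
  ... | no g≢e   | no g≢f   with split-at W g∈W
  ... | split W₁ jg W₂ eq
    with trail-split {p = W₁} {s = W₂} tr eq
       | head-++-∈ (edges W₁) (subst (λ l → head l ≡ just e) eq head≡e) g≢e
       | last-++-∈ (edges W₁) (subst (λ l → last l ≡ just f) eq last≡f) g≢f
  ... | av₁ , av₂ , tr₁ , tr₂ | e∈W₁ | f∈W₂
    with trail-after-edge W₁ tr₁ e∈W₁ av₁ | trail-before-edge W₂ tr₂ f∈W₂ av₂
  ... | _ , _ , je , c'~a∖e , c'~a∖g | _ , _ , jf , d'~b∖f , d'~b∖g =
    essential-if-bridge-sides jg λ sep →
      essential-side (≢-sym g≢e) jg sep ess-e je c'~a∖g c'~a∖e ,
      essential-side (≢-sym g≢f) (joins-sym jg) (sep ∘ connected-sym) ess-f jf d'~b∖g d'~b∖f
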